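{- Let $\mathsf M,\mathsf N$ be EAMs and $\alpha,\beta$ types. (1) If $\mathsf M:\beta\to\alpha$ and $\mathsf N:\beta$ then $\mathsf M@[\#\mathsf N]:\alpha$. (2) If $\mathsf M:\alpha$ and $\mathsf M\to_{\mathsf c}\mathsf N$ then $\mathsf N:\alpha$. (3) If $\mathsf M:\mathsf{int}$ then either $\mathsf M$ does not terminate or $\mathsf M\twoheadrightarrow_{\mathsf c}\mathsf n$ for some $n\ge 0$. (4) If $\mathsf M:\alpha$ then $\mathsf M$ does not raise an error.
   Context: Fix a countably infinite set $\mathbb A$ of addresses with $\mathbb N\subseteq\mathbb A$, $\mathbb A\setminus\mathbb N$ infinite, and $\varnothing\notin\mathbb A$. Tapes are finite lists of addresses ($a::T$ cons, $T@T'$ concatenation). Programs: $P::=\mathtt{Load}\,i;P\mid A$, $A::=\mathtt{App}(i,j,k);A\mid\mathtt{Test}(i,j,k,l);A\mid\mathtt{Pred}(i,j);A\mid\mathtt{Succ}(i,j);A\mid C$, $C::=\mathtt{Call}\,i\mid\varepsilon$. An EAM is $\langle R_0,\dots,R_r,P,T\rangle$ with $!R_i\in\mathbb A\cup\{\varnothing\}$ and a valid program (never reads an uninitialised or nonexistent register, never writes via App/Pred/Succ/Test to a nonexistent register; Load into a nonexistent register discards). $\vec R[R_i:=a]$ updates a register; $\mathsf M@T'$ appends $T'$ to the tape. Numeral machines $\mathsf n=\langle R_0=n,\varepsilon,[]\rangle$; $\mathsf Y^a=\langle R_0=\varnothing,R_1=\varnothing,\mathtt{Load}\,0;\mathtt{Load}\,1;\mathtt{App}(0,1,0);\mathtt{App}(1,0,1);\mathtt{Call}\,1,[a]\rangle$.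 A fixed bijection $\#$ from EAMs onto $\mathbb A$ satisfies $\#\mathsf n=n$ and $\#(\mathsf Y^a)=a$ for some $a\in\mathbb A\setminus\mathbb N$ (this machine is $\mathsf Y$); $a\cdot b=\#(\#^{ -1}(a)@[b])$. Reduction $\to_{\mathsf c}$: $\langle\vec R,\mathtt{Call}\,i,T\rangle\to\#^{ -1}(!R_i)@T$; $\langle\vec R,\mathtt{Load}\,i;P,a::T\rangle\to\langle\vec R[R_i:=a],P,T\rangle$; $\langle\vec R,\mathtt{App}(i,j,k);P,T\rangle\to\langle\vec R[R_k:=!R_i\cdot!R_j],P,T\rangle$; if $!R_i\in\mathbb N$: $\mathtt{Pred}(i,j)$ sets $R_j:=\max(!R_i-1,0)$, $\mathtt{Succ}(i,j)$ sets $R_j:=!R_i+1$, $\mathtt{Test}(i,j,k,l)$ sets $R_l:=!R_j$ if $!R_i=0$ and $R_l:=!R_k$ otherwise (each consuming the instruction); if $\#^{ -1}(!R_i)\to_{\mathsf c}\mathsf M'$ and the first instruction is $\mathtt{Pred}(i,j)$, $\mathtt{Succ}(i,j)$ or $\mathtt{Test}(i,j,k,l)$, the machine steps to itself with $R_i:=\#\mathsf M'$. $\twoheadrightarrow_{\mathsf c}$ is the reflexive-transitive closure. An EAM is in an error state if its program starts with $\mathtt{Pred}(i,j)$, $\mathtt{Succ}(i,j)$ or $\mathtt{Test}(i,j,k,l)$ while $!R_i\notin\mathbb N$ and $\#^{ -1}(!R_i)$ cannot reduce; it is in final state if it is not in an error state and cannot reduce. $\mathsf M$ raises an error (resp. reaches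 a final state) if $\mathsf M\twoheadrightarrow_{\mathsf c}\mathsf M'$ with $\mathsf M'$ in error (resp. final) state; otherwise it does not terminate. EAM typing: contexts $\Delta$ are finite maps indices$\to$types, $\Delta[i:\alpha]$ sets/adds. Judgements $\mathsf M:\alpha$, $\Delta\Vdash^r(P,T):\alpha$, $R_0..R_r\models\Delta$ are the least relations with: $\mathsf n:\mathsf{int}$; $\mathsf Y:(\alpha\to\alpha)\to\alpha$; $R_0..R_r\models\Delta$ and $\Delta\Vdash^r(P,T):\alpha$ give $\langle R_0..R_r,P,T\rangle:\alpha$; empty registers $\models$ empty context; $R_0..R_{r-1}\models\Delta$ and $!R_r=\varnothing$ give $R_0..R_r\models\Delta$; $R_0..R_{r-1}\models\Delta$ and $\#^{ -1}(!R_r):\alpha$ give $R_0..R_r\models\Delta,r:\alpha$; $\Delta[i:\beta]\Vdash^r(P,[]):\alpha\Rightarrow\Delta\Vdash^r(\mathtt{Load}\,i;P,[]):\beta\to\alpha$; $\Delta[i:\beta]\Vdash^r(P,T):\alpha$ and $\#^{ -1}(a):\beta\Rightarrow\Delta\Vdash^r(\mathtt{Load}\,i;P,a::T):\alpha$; $(\Delta,i:\mathsf{int})[j:\mathsf{int}]\Vdash^r(P,T):\alpha\Rightarrow\Delta,i:\mathsf{int}\Vdash^r(\mathtt{Pred}(i,j);P,T):\alpha$, same for $\mathtt{Succ}$; $(\Delta,i:\mathsf{int},j:\beta,k:\beta)[l:\beta]\Vdash^r(P,T):\alpha\Rightarrow\Delta,i:\mathsf{int},j:\beta,k:\beta\Vdash^r(\mathtt{Test}(i,j,k,l);P,T):\alpha$;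 $(\Delta,i:\alpha\to\beta,j:\alpha)[k:\beta]\Vdash^r(P,T):\delta\Rightarrow\Delta,i:\alpha\to\beta,j:\alpha\Vdash^r(\mathtt{App}(i,j,k);P,T):\delta$; $\mathsf M_1:\alpha_1,\dots,\mathsf M_n:\alpha_n\Rightarrow\Delta,i:\alpha_1\to\cdots\to\alpha_n\to\alpha\Vdash^r(\mathtt{Call}\,i,[\#\mathsf M_1,\dots,\#\mathsf M_n]):\alpha$. -}

module Defs where

open import Data.Nat using (ℕ; zero; suc; _∸_; _<ᵇ_; _≡ᵇ_)
open import Data.Bool using (Bool; true; false; _∧_; if_then_else_; T)
open import Data.Maybe using (Maybe; just; nothing; is-just)
open import Data.Sum using (_⊎_; inj₁; inj₂)
open import Data.Product using (Σ; ∃; _×_; _,_; proj₁)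
open import Data.List using (List; []; _∷_; _++_; map; foldr)
open import Data.List.Relation.Binary.Pointwise using (Pointwise)
open import Data.Vec using (Vec; []; _∷_; _∷ʳ_)
open import Data.Unit using (tt)
open import Relation.Binary.PropositionalEquality using (_≡_)
open import Relation.Binary.Construct.Closure.ReflexiveTransitive using (Star)
open import Relation.Nullary using (¬_)
open import Function.Bundles using (_↔_)

-- Addresses: 𝔸 = ℕ ⊎ X  (ℕ ⊆ 𝔸, X = 𝔸 ∖ ℕ).  The empty register
-- content ∅ is modelled by `nothing` (so ∅ ∉ 𝔸 automatically).

Addr : Set → Set
Addr X = ℕ ⊎ X

data Cmd : Set where
  call : ℕ → Cmd
  ε    : Cmd

data Body : Set where
  app  : ℕ → ℕ → ℕ → Body → Body
  test : ℕ → ℕ → ℕ → ℕ → Body → Body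
  pred : ℕ → ℕ → Body → Body
  succ : ℕ → ℕ → Body → Body
  cmd  : Cmd → Body

data Prog : Set where
  load : ℕ → Prog → Prog
  body : Body → Prog

-- Register access by a natural-number index (out of range: reads give
-- the default, writes are discarded).

lookupD : ∀ {A : Set} {n} → A → Vec A n → ℕ → A
lookupD d []       _       = d
lookupD d (x ∷ xs) zero    = x
lookupD d (x ∷ xs) (suc i) = lookupD d xs i

setD : ∀ {A : Set} {n} → Vec A n → ℕ → A → Vec A n
setD []       _       _ = []
setD (x ∷ xs) zero    a = a ∷ xs
setD (x ∷ xs) (suc i) a = x ∷ setD xs i a

-- Validity of a program w.r.t. the set of initialised registers
-- (a vector of booleans, one per existing register).

module _ {n : ℕ} where
  validB : Vec Bool n → Body → Bool
  validB ini (app i j k P) =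
    lookupD false ini i ∧ lookupD false ini j ∧ (k <ᵇ n) ∧ validB (setD ini k true) P
  validB ini (test i j k l P) =
    lookupD false ini i ∧ lookupD false ini j ∧ lookupD false ini k ∧ (l <ᵇ n)
      ∧ validB (setD ini l true) P
  validB ini (pred i j P) = lookupD false ini i ∧ (j <ᵇ n) ∧ validB (setD ini j true) P
  validB ini (succ i j P) = lookupD false ini i ∧ (j <ᵇ n) ∧ validB (setD ini j true) P
  validB ini (cmd (call i)) = lookupD false ini i
  validB ini (cmd ε) = true

  -- Load into a nonexistent register: setD is a no-op (discarded)
  validP : Vec Bool n → Prog → Bool
  validP ini (load i P) = validP (setD ini i true) P
  validP ini (body B)   = validB ini B

record Raw (X : Set) : Set where
  constructor mk
  field
    r    : ℕ
    regs : Vec (Maybe (Addr X)) (suc r)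
    prog : Prog
    tape : List (Addr X)
open Raw public

initOf : ∀ {X n} → Vec (Maybe (Addr X)) n → Vec Bool n
initOf []       = []
initOf (x ∷ xs) = is-just x ∷ initOf xs

Valid : ∀ {X} → Raw X → Set
Valid M = T (validP (initOf (regs M)) (prog M))

EAM : Set → Set
EAM X = Σ (Raw X) Valid

⌊_⌋ : ∀ {X} → EAM X → Raw X
⌊_⌋ = proj₁

_⊕ʳ_ : ∀ {X} → Raw X → List (Addr X) → Raw X
mk r Rs P T ⊕ʳ T' = mk r Rs P (T ++ T')

_⊕_ : ∀ {X} → EAM X → List (Addr X) → EAM X
(M , v) ⊕ T' = (M ⊕ʳ T') , v

numeralʳ : ∀ {X} → ℕ → Raw X
numeralʳ n = mk 0 (just (inj₁ n) ∷ []) (body (cmd ε)) []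

numeral : ∀ {X} → ℕ → EAM X
numeral n = numeralʳ n , tt

Yʳ : ∀ {X} → Addr X → Raw X
Yʳ a = mk 1 (nothing ∷ nothing ∷ [])
  (load 0 (load 1 (body (app 0 1 0 (app 1 0 1 (cmd (call 1)))))))
  (a ∷ [])

Ymach : ∀ {X} → Addr X → EAM X
Ymach a = Yʳ a , tt

-- The fixed data: 𝔸 ∖ ℕ = X countably infinite, a bijection # from EAMs
-- onto 𝔸 with #n = n and #(Y^a) = a for a chosen a ∈ 𝔸 ∖ ℕ.

record Setting (X : Set) : Set where
  field
    X-countable : X ↔ ℕ
    encode      : EAM X → Addr X
    decode      : Addr X → EAM X
    decode-encode : ∀ M → decode (encode M) ≡ M
    encode-decode : ∀ a → encode (decode a) ≡ a
    encode-numeral : ∀ n → encode (numeral n) ≡ inj₁ n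
    yAddr       : X
    encode-Y    : encode (Ymach (inj₂ yAddr)) ≡ inj₂ yAddr

data Ty : Set where
  int : Ty
  _⇒_ : Ty → Ty → Ty
infixr 5 _⇒_

_⇛_ : List Ty → Ty → Ty
αs ⇛ α = foldr _⇒_ α αs

Ctx : Set
Ctx = ℕ → Maybe Ty

∅ctx : Ctx
∅ctx _ = nothing

_[_↦_] : Ctx → ℕ → Ty → Ctx
(Δ [ i ↦ β ]) n = if n ≡ᵇ i then just β else Δ n

module Semantics {X : Set} (S : Setting X) where
  open Setting S public

  _·_ : Addr X → Addr X → Addr X
  a · b = encode (decode a ⊕ (b ∷ []))

  !_[_] : ∀ {n} → Vec (Maybe (Addr X)) n → ℕ → Maybe (Addr X)
  ! Rs [ i ] = lookupD nothing Rs i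

  infix 4 _⟶_
  data _⟶_ : Raw X → Raw X → Set where
    callS : ∀ {r Rs i T a} → ! Rs [ i ] ≡ just a →
      mk r Rs (body (cmd (call i))) T ⟶ (⌊ decode a ⌋ ⊕ʳ T)
    loadS : ∀ {r Rs i P a T} →
      mk r Rs (load i P) (a ∷ T) ⟶ mk r (setD Rs i (just a)) P T
    appS : ∀ {r Rs i j k P T a b} → ! Rs [ i ] ≡ just a → ! Rs [ j ] ≡ just b →
      mk r Rs (body (app i j k P)) T ⟶ mk r (setD Rs k (just (a · b))) (body P) T
    predS : ∀ {r Rs i j P T n} → ! Rs [ i ] ≡ just (inj₁ n) →
      mk r Rs (body (pred i j P)) T ⟶ mk r (setD Rs j (just (inj₁ (n ∸ 1)))) (body P) T
    succS : ∀ {r Rs i j P T n} → ! Rs [ i ] ≡ just (inj₁ n) →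
      mk r Rs (body (succ i j P)) T ⟶ mk r (setD Rs j (just (inj₁ (suc n)))) (body P) T
    testZ : ∀ {r Rs i j k l P T} → ! Rs [ i ] ≡ just (inj₁ 0) →
      mk r Rs (body (test i j k l P)) T ⟶ mk r (setD Rs l (! Rs [ j ])) (body P) T
    testS : ∀ {r Rs i j k l P T n} → ! Rs [ i ] ≡ just (inj₁ (suc n)) →
      mk r Rs (body (test i j k l P)) T ⟶ mk r (setD Rs l (! Rs [ k ])) (body P) T
    predE : ∀ {r Rs i j P T a} (M' : EAM X) → ! Rs [ i ] ≡ just a → ⌊ decode a ⌋ ⟶ ⌊ M' ⌋ →
      mk r Rs (body (pred i j P)) T ⟶ mk r (setD Rs i (just (encode M'))) (body (pred i j P)) T
    succE : ∀ {r Rs i j P T a} (M' : EAM X) → ! Rs [ i ] ≡ just a → ⌊ decode a ⌋ ⟶ ⌊ M' ⌋ →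
      mk r Rs (body (succ i j P)) T ⟶ mk r (setD Rs i (just (encode M'))) (body (succ i j P)) T
    testE : ∀ {r Rs i j k l P T a} (M' : EAM X) → ! Rs [ i ] ≡ just a → ⌊ decode a ⌋ ⟶ ⌊ M' ⌋ →
      mk r Rs (body (test i j k l P)) T ⟶ mk r (setD Rs i (just (encode M'))) (body (test i j k l P)) T

  infix 4 _⟶*_
  _⟶*_ : Raw X → Raw X → Set
  _⟶*_ = Star _⟶_

  CannotReduce : Raw X → Set
  CannotReduce M = ∀ M' → ¬ (M ⟶ M')

  NotNat : Addr X → Set
  NotNat a = ∀ n → ¬ (a ≡ inj₁ n)

  data ErrorState : Raw X → Set where
    predErr : ∀ {r Rs i j P T a} → ! Rs [ i ] ≡ just a → NotNat a →
      CannotReduce ⌊ decode a ⌋ → ErrorState (mk r Rs (body (pred i j P)) T)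
    succErr : ∀ {r Rs i j P T a} → ! Rs [ i ] ≡ just a → NotNat a →
      CannotReduce ⌊ decode a ⌋ → ErrorState (mk r Rs (body (succ i j P)) T)
    testErr : ∀ {r Rs i j k l P T a} → ! Rs [ i ] ≡ just a → NotNat a →
      CannotReduce ⌊ decode a ⌋ → ErrorState (mk r Rs (body (test i j k l P)) T)

  FinalState : Raw X → Set
  FinalState M = ¬ ErrorState M × CannotReduce M

  RaisesError : Raw X → Set
  RaisesError M = ∃ λ M' → M ⟶* M' × ErrorState M'

  ReachesFinal : Raw X → Set
  ReachesFinal M = ∃ λ M' → M ⟶* M' × FinalState M'

  DoesNotTerminate : Raw X → Set
  DoesNotTerminate M = ¬ RaisesError M × ¬ ReachesFinal M

  -- the negation of "does not terminate", stated positively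
  Terminates : Raw X → Set
  Terminates M = RaisesError M ⊎ ReachesFinal M

  Y : Raw X
  Y = Yʳ (inj₂ yAddr)

  infix 4 _∶_ _⊨_ _⊩_⟨_,_⟩∶_
  data _∶_ : Raw X → Ty → Set
  data _⊨_ : ∀ {n} → Vec (Maybe (Addr X)) n → Ctx → Set
  data _⊩_⟨_,_⟩∶_ : Ctx → ℕ → Prog → List (Addr X) → Ty → Set

  data _∶_ where
    numT  : ∀ n → numeralʳ n ∶ int
    YT    : ∀ α → Y ∶ ((α ⇒ α) ⇒ α)
    machT : ∀ {r Rs P T Δ α} → Rs ⊨ Δ → Δ ⊩ r ⟨ P , T ⟩∶ α → mk r Rs P T ∶ α

  data _⊨_ where
    emptyR : [] ⊨ ∅ctx
    noneR  : ∀ {n} {Rs : Vec _ n} {Δ} → Rs ⊨ Δ → (Rs ∷ʳ nothing) ⊨ Δ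
    someR  : ∀ {n} {Rs : Vec _ n} {Δ a α} → Rs ⊨ Δ → ⌊ decode a ⌋ ∶ α →
      (Rs ∷ʳ just a) ⊨ (Δ [ n ↦ α ])

  data _⊩_⟨_,_⟩∶_ where
    loadE : ∀ {Δ r i P α β} → Δ [ i ↦ β ] ⊩ r ⟨ P , [] ⟩∶ α →
      Δ ⊩ r ⟨ load i P , [] ⟩∶ (β ⇒ α)
    loadT : ∀ {Δ r i P a T α β} → Δ [ i ↦ β ] ⊩ r ⟨ P , T ⟩∶ α → ⌊ decode a ⌋ ∶ β →
      Δ ⊩ r ⟨ load i P , a ∷ T ⟩∶ α
    predT : ∀ {Δ r i j P T α} → Δ i ≡ just int → Δ [ j ↦ int ] ⊩ r ⟨ body P , T ⟩∶ α →
      Δ ⊩ r ⟨ body (pred i j P) , T ⟩∶ α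
    succT : ∀ {Δ r i j P T α} → Δ i ≡ just int → Δ [ j ↦ int ] ⊩ r ⟨ body P , T ⟩∶ α →
      Δ ⊩ r ⟨ body (succ i j P) , T ⟩∶ α
    testT : ∀ {Δ r i j k l P T α β} → Δ i ≡ just int → Δ j ≡ just β → Δ k ≡ just β →
      Δ [ l ↦ β ] ⊩ r ⟨ body P , T ⟩∶ α →
      Δ ⊩ r ⟨ body (test i j k l P) , T ⟩∶ α
    appT : ∀ {Δ r i j k P T α β δ} → Δ i ≡ just (α ⇒ β) → Δ j ≡ just α →
      Δ [ k ↦ β ] ⊩ r ⟨ body P , T ⟩∶ δ →
      Δ ⊩ r ⟨ body (app i j k P) , T ⟩∶ δ
    callT : ∀ {Δ r i α} (Ms : List (EAM X)) (αs : List Ty) →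
      Pointwise (λ M β → ⌊ M ⌋ ∶ β) Ms αs → Δ i ≡ just (αs ⇛ α) →
      Δ ⊩ r ⟨ body (cmd (call i)) , map encode Ms ⟩∶ α

-- The register typing ⊨ pins the context down exactly, which a reduction step does not
-- respect (Load may target a nonexistent register, and contexts are functions, so there is
-- no extensionality to rewrite them).  Subject reduction is therefore proved for a looser
-- invariant: every filled register holds an address whose decoding has the type the
-- context gives it.  A valid program reads only initialised registers, so its typing only
-- depends on the context there, and the invariant can always be turned back into a
-- ⊨-derivation.  Typing M @ [#N] (part 1) is what types the results of App and Call.
-- Parts 3 and 4 rest on progress at int: a valid machine of type int is a numeral or
-- steps; since Pred, Succ and Test only inspect registers of type int, no typable machine
-- is in an error state, and a final one of type int is a numeral.
module Submission where

open import Defs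
open import Data.Nat using (ℕ; zero; suc; _∸_; _≡ᵇ_)
open import Data.Nat.Properties using (≡ᵇ⇒≡)
open import Data.Bool using (Bool; true; false; _∧_; T; if_then_else_)
open import Data.Bool.Properties using (T-∧; T-≡)
open import Data.Maybe using (Maybe; just; nothing; is-just)
open import Data.Sum using (_⊎_; inj₁; inj₂)
open import Data.Product using (∃; _×_; _,_; proj₁; proj₂)
open import Data.List using (List; []; _∷_; _++_; map)
open import Data.List.Properties using (++-assoc; ++-identityʳ; map-++; foldr-++)
open import Data.List.Relation.Binary.Pointwise using (Pointwise; []; _∷_; ++⁺)
open import Data.Vec using (Vec; []; _∷_; _∷ʳ_; initLast)
open import Data.Unit using (⊤; tt)
open import Data.Empty using (⊥-elim)
open import Function.Base using (_∘_)
open import Function.Bundles using (Equivalence)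
open import Relation.Binary.PropositionalEquality
open import Relation.Binary.Construct.Closure.ReflexiveTransitive using (_◅_) renaming (ε to ◅ε)
open import Relation.Nullary using (¬_)

private
  variable
    A : Set
    n : ℕ

∧-split : ∀ {x y} → T (x ∧ y) → T x × T y
∧-split = Equivalence.to T-∧

≡ᵇ-true⇒≡ : ∀ m n → (m ≡ᵇ n) ≡ true → m ≡ n
≡ᵇ-true⇒≡ m n eq = ≡ᵇ⇒≡ m n (subst T (sym eq) tt)

lookupD-length : ∀ (d : A) (xs : Vec A n) → lookupD d xs n ≡ d
lookupD-length d []       = refl
lookupD-length d (x ∷ xs) = lookupD-length d xs

lookupD-∷ʳ : ∀ (d : A) (xs : Vec A n) y x →
  lookupD d (xs ∷ʳ y) x ≡ (if x ≡ᵇ n then y else lookupD d xs x)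
lookupD-∷ʳ d []       y zero    = refl
lookupD-∷ʳ d []       y (suc x) = refl
lookupD-∷ʳ d (z ∷ zs) y zero    = refl
lookupD-∷ʳ d (z ∷ zs) y (suc x) = lookupD-∷ʳ d zs y x

lookupD-∷ʳ-last : ∀ (d : A) (xs : Vec A n) y → lookupD d (xs ∷ʳ y) n ≡ y
lookupD-∷ʳ-last d []       y = refl
lookupD-∷ʳ-last d (x ∷ xs) y = lookupD-∷ʳ-last d xs y

lookupD-∷ʳ-init : ∀ (xs : Vec (Maybe A) n) y x {a} →
  lookupD nothing xs x ≡ just a → lookupD nothing (xs ∷ʳ y) x ≡ just a
lookupD-∷ʳ-init {n = n} xs y x xs[x] rewrite lookupD-∷ʳ nothing xs y x with x ≡ᵇ n in eq
... | false = xs[x]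
... | true with refl ← ≡ᵇ-true⇒≡ x n eq with () ← trans (sym (lookupD-length nothing xs)) xs[x]

lookupD-setD-≢ : ∀ (d : A) (xs : Vec A n) k v x → (x ≡ᵇ k) ≡ false →
  lookupD d (setD xs k v) x ≡ lookupD d xs x
lookupD-setD-≢ d []       k       v x       _ = refl
lookupD-setD-≢ d (y ∷ ys) zero    v zero    ()
lookupD-setD-≢ d (y ∷ ys) zero    v (suc x) _ = refl
lookupD-setD-≢ d (y ∷ ys) (suc k) v zero    _ = refl
lookupD-setD-≢ d (y ∷ ys) (suc k) v (suc x) e = lookupD-setD-≢ d ys k v x e

lookupD-setD-just : ∀ (xs : Vec (Maybe A) n) k v {a} →
  lookupD nothing (setD xs k v) k ≡ just a → v ≡ just a
lookupD-setD-just (y ∷ ys) zero    v e = e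
lookupD-setD-just (y ∷ ys) (suc k) v e = lookupD-setD-just ys k v e

setD-lookupD : ∀ (d : A) (xs : Vec A n) k → setD xs k (lookupD d xs k) ≡ xs
setD-lookupD d []       k       = refl
setD-lookupD d (y ∷ ys) zero    = refl
setD-lookupD d (y ∷ ys) (suc k) = cong (y ∷_) (setD-lookupD d ys k)

setD-true : ∀ (ini : Vec Bool n) i → T (lookupD false ini i) → setD ini i true ≡ ini
setD-true ini i t =
  subst (λ b → setD ini i b ≡ ini) (Equivalence.to T-≡ t) (setD-lookupD false ini i)

lookupD-initOf : ∀ {X} (Rs : Vec (Maybe (Addr X)) n) x →
  lookupD false (initOf Rs) x ≡ is-just (lookupD nothing Rs x)
lookupD-initOf []       x       = refl
lookupD-initOf (r ∷ Rs) zero    = refl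
lookupD-initOf (r ∷ Rs) (suc x) = lookupD-initOf Rs x

initOf-setD : ∀ {X} (Rs : Vec (Maybe (Addr X)) n) k v →
  initOf (setD Rs k v) ≡ setD (initOf Rs) k (is-just v)
initOf-setD []       k       v = refl
initOf-setD (x ∷ Rs) zero    v = refl
initOf-setD (x ∷ Rs) (suc k) v = cong (is-just x ∷_) (initOf-setD Rs k v)

is-just⇒just : (m : Maybe A) → T (is-just m) → ∃ λ a → m ≡ just a
is-just⇒just (just a) _ = a , refl

[↦]-redundant : ∀ (Δ : Ctx) i β → Δ i ≡ just β → ∀ x → (Δ [ i ↦ β ]) x ≡ Δ x
[↦]-redundant Δ i β Δi x with x ≡ᵇ i in eq
... | false = refl
... | true with refl ← ≡ᵇ-true⇒≡ x i eq = sym Δi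

Initialised : Vec Bool n → ℕ → Set
Initialised ini i = T (lookupD false ini i)

ValidBody : Vec Bool n → Body → Set
ValidBody ini (app i j k P) =
  Initialised ini i × Initialised ini j × T (validB (setD ini k true) P)
ValidBody ini (test i j k l P) =
  Initialised ini i × Initialised ini j × Initialised ini k × T (validB (setD ini l true) P)
ValidBody ini (pred i j P)   = Initialised ini i × T (validB (setD ini j true) P)
ValidBody ini (succ i j P)   = Initialised ini i × T (validB (setD ini j true) P)
ValidBody ini (cmd (call i)) = Initialised ini i
ValidBody ini (cmd ε)        = ⊤

validB⇒ValidBody : ∀ (ini : Vec Bool n) B → T (validB ini B) → ValidBody ini B
validB⇒ValidBody ini (app i j k P) v =
  let ti , v₁ = ∧-split v; tj , v₂ = ∧-split v₁ in ti , tj , proj₂ (∧-split v₂)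
validB⇒ValidBody ini (test i j k l P) v =
  let ti , v₁ = ∧-split v; tj , v₂ = ∧-split v₁; tk , v₃ = ∧-split v₂
  in ti , tj , tk , proj₂ (∧-split v₃)
validB⇒ValidBody ini (pred i j P) v = let ti , v₁ = ∧-split v in ti , proj₂ (∧-split v₁)
validB⇒ValidBody ini (succ i j P) v = let ti , v₁ = ∧-split v in ti , proj₂ (∧-split v₁)
validB⇒ValidBody ini (cmd (call i)) v = v
validB⇒ValidBody ini (cmd ε) v = tt

Agree : Vec Bool n → Ctx → Ctx → Set
Agree ini Δ Δ′ = ∀ x τ → Initialised ini x → Δ x ≡ just τ → Δ′ x ≡ just τ

Agree-[↦] : ∀ (ini : Vec Bool n) {Δ Δ′} → Agree ini Δ Δ′ → ∀ k β →
  Agree (setD ini k true) (Δ [ k ↦ β ]) (Δ′ [ k ↦ β ])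
Agree-[↦] ini ag k β x τ t Δx with x ≡ᵇ k in eq
... | true  = Δx
... | false = ag x τ (subst T (lookupD-setD-≢ false ini k true x eq) t) Δx

module Properties {X : Set} (S : Setting X) where
  open Semantics S

  ∶-subst : ∀ {M N : EAM X} {α} → M ≡ N → ⌊ M ⌋ ∶ α → ⌊ N ⌋ ∶ α
  ∶-subst {α = α} = subst (λ K → ⌊ K ⌋ ∶ α)

  decode-numeral : ∀ n → decode (inj₁ n) ≡ numeral n
  decode-numeral n = trans (cong decode (sym (encode-numeral n))) (decode-encode (numeral n))

  decode-Y : decode (inj₂ yAddr) ≡ Ymach (inj₂ yAddr)
  decode-Y = trans (cong decode (sym encode-Y)) (decode-encode _)

  decode-numeral-∶ : ∀ n → ⌊ decode (inj₁ n) ⌋ ∶ int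
  decode-numeral-∶ n = ∶-subst (sym (decode-numeral n)) (numT n)

  decode-Y-∶ : ∀ α → ⌊ decode (inj₂ yAddr) ⌋ ∶ ((α ⇒ α) ⇒ α)
  decode-Y-∶ α = ∶-subst (sym decode-Y) (YT α)

  decode-encode-∶ : ∀ (N : EAM X) {β} → ⌊ N ⌋ ∶ β → ⌊ decode (encode N) ⌋ ∶ β
  decode-encode-∶ N = ∶-subst (sym (decode-encode N))

  decode≡numeral : ∀ a {n} → ⌊ decode a ⌋ ≡ numeralʳ n → a ≡ inj₁ n
  decode≡numeral a {n} e = begin
    a                      ≡⟨ sym (encode-decode a) ⟩
    encode (decode a)      ≡⟨ cong encode (valid-irrelevant (decode a) e) ⟩
    encode (numeral n)     ≡⟨ encode-numeral n ⟩
    inj₁ n                 ∎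
    where
    open ≡-Reasoning
    valid-irrelevant : ∀ (M : EAM X) → ⌊ M ⌋ ≡ numeralʳ n → M ≡ numeral n
    valid-irrelevant (M , _) refl = refl

  initialised-register : ∀ (Rs : Vec (Maybe (Addr X)) n) x →
    Initialised (initOf Rs) x → ∃ λ a → ! Rs [ x ] ≡ just a
  initialised-register Rs x t = is-just⇒just (! Rs [ x ]) (subst T (lookupD-initOf Rs x) t)

  written-Valid : ∀ (Rs : Vec (Maybe (Addr X)) n) k v P → T (is-just v) →
    T (validP (setD (initOf Rs) k true) P) → T (validP (initOf (setD Rs k v)) P)
  written-Valid Rs k v P tv
    rewrite initOf-setD Rs k v | Equivalence.to T-≡ tv = λ valid → valid

  overwritten-Valid : ∀ (Rs : Vec (Maybe (Addr X)) n) i c P → Initialised (initOf Rs) i →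
    T (validP (initOf Rs) P) → T (validP (initOf (setD Rs i (just c))) P)
  overwritten-Valid Rs i c P ti valid =
    written-Valid Rs i (just c) P tt
      (subst (λ ini → T (validP ini P)) (sym (setD-true _ i ti)) valid)

  copied-Valid : ∀ (Rs : Vec (Maybe (Addr X)) n) l j P → Initialised (initOf Rs) j →
    T (validP (setD (initOf Rs) l true) P) → T (validP (initOf (setD Rs l (! Rs [ j ]))) P)
  copied-Valid Rs l j P tj = written-Valid Rs l (! Rs [ j ]) P (subst T (lookupD-initOf Rs j) tj)

  ⟶-Valid : ∀ {M N} → Valid M → M ⟶ N → Valid N
  ⟶-Valid {mk _ Rs _ _} v (loadS {i = i} {P = P} {a = a}) = written-Valid Rs i (just a) P tt v
  ⟶-Valid v (callS {a = a} _) = proj₂ (decode a)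
  ⟶-Valid {mk _ Rs (body B) _} v (appS {k = k} {P = P} _ _) =
    let _ , _ , vP = validB⇒ValidBody (initOf Rs) B v in written-Valid Rs k _ (body P) tt vP
  ⟶-Valid {mk _ Rs (body B) _} v (predS {j = j} {P = P} _) =
    let _ , vP = validB⇒ValidBody (initOf Rs) B v in written-Valid Rs j _ (body P) tt vP
  ⟶-Valid {mk _ Rs (body B) _} v (succS {j = j} {P = P} _) =
    let _ , vP = validB⇒ValidBody (initOf Rs) B v in written-Valid Rs j _ (body P) tt vP
  ⟶-Valid {mk _ Rs (body B) _} v (testZ {j = j} {l = l} {P = P} _) =
    let _ , tj , _ , vP = validB⇒ValidBody (initOf Rs) B v in copied-Valid Rs l j (body P) tj vP
  ⟶-Valid {mk _ Rs (body B) _} v (testS {k = k} {l = l} {P = P} _) =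
    let _ , _ , tk , vP = validB⇒ValidBody (initOf Rs) B v in copied-Valid Rs l k (body P) tk vP
  ⟶-Valid {mk _ Rs (body B) _} v (predE {i = i} M′ _ _) =
    overwritten-Valid Rs i (encode M′) (body B) (proj₁ (validB⇒ValidBody (initOf Rs) B v)) v
  ⟶-Valid {mk _ Rs (body B) _} v (succE {i = i} M′ _ _) =
    overwritten-Valid Rs i (encode M′) (body B) (proj₁ (validB⇒ValidBody (initOf Rs) B v)) v
  ⟶-Valid {mk _ Rs (body B) _} v (testE {i = i} M′ _ _) =
    overwritten-Valid Rs i (encode M′) (body B) (proj₁ (validB⇒ValidBody (initOf Rs) B v)) v

  record RegistersTyped {n} (Rs : Vec (Maybe (Addr X)) n) (Δ : Ctx) : Set where
    field
      content-∶ : ∀ x a → ! Rs [ x ] ≡ just a → ∃ λ τ → Δ x ≡ just τ × ⌊ decode a ⌋ ∶ τ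
  open RegistersTyped

  register-∶ : ∀ {Rs : Vec (Maybe (Addr X)) n} {Δ β} → RegistersTyped Rs Δ →
    ∀ x → Δ x ≡ just β → ∀ a → ! Rs [ x ] ≡ just a → ⌊ decode a ⌋ ∶ β
  register-∶ typed x Δx a Rx with content-∶ typed x a Rx
  ... | τ , Δx′ , ⊢a with refl ← trans (sym Δx′) Δx = ⊢a

  RegistersTyped-≗ : ∀ {Rs : Vec (Maybe (Addr X)) n} {Δ₁ Δ₂} →
    RegistersTyped Rs Δ₁ → Δ₁ ≗ Δ₂ → RegistersTyped Rs Δ₂
  RegistersTyped-≗ typed Δ₁≗Δ₂ .content-∶ x a Rx =
    let τ , Δx , ⊢a = content-∶ typed x a Rx in τ , trans (sym (Δ₁≗Δ₂ x)) Δx , ⊢a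

  RegistersTyped-[↦] : ∀ {Rs : Vec (Maybe (Addr X)) n} {Δ} k v β → RegistersTyped Rs Δ →
    (∀ a → v ≡ just a → ⌊ decode a ⌋ ∶ β) → RegistersTyped (setD Rs k v) (Δ [ k ↦ β ])
  RegistersTyped-[↦] {Rs = Rs} k v β typed ⊢v .content-∶ x a Rx with x ≡ᵇ k in eq
  ... | false = content-∶ typed x a (trans (sym (lookupD-setD-≢ nothing Rs k v x eq)) Rx)
  ... | true with refl ← ≡ᵇ-true⇒≡ x k eq = β , refl , ⊢v a (lookupD-setD-just Rs k v Rx)

  ⊨-sound : ∀ {Rs : Vec (Maybe (Addr X)) n} {Δ} → Rs ⊨ Δ → RegistersTyped Rs Δ
  ⊨-sound emptyR .content-∶ x a ()
  ⊨-sound (noneR {n = m} {Rs = Rs} W) .content-∶ x a Rx rewrite lookupD-∷ʳ nothing Rs nothing x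
    with x ≡ᵇ m
  ... | true with () ← Rx
  ... | false = content-∶ (⊨-sound W) x a Rx
  ⊨-sound (someR {n = m} {Rs = Rs} {a = b} {α = α} W ⊢b) .content-∶ x a Rx
    rewrite lookupD-∷ʳ nothing Rs (just b) x with x ≡ᵇ m
  ... | true with refl ← Rx = α , refl , ⊢b
  ... | false = content-∶ (⊨-sound W) x a Rx

  RegistersTyped-init : ∀ {ys : Vec (Maybe (Addr X)) n} {Δ} y →
    RegistersTyped (ys ∷ʳ y) Δ → RegistersTyped ys Δ
  RegistersTyped-init {ys = ys} y typed .content-∶ x a =
    content-∶ typed x a ∘ lookupD-∷ʳ-init ys y x

  ⊨-complete : ∀ (Rs : Vec (Maybe (Addr X)) n) {Δ} → RegistersTyped Rs Δ →
    ∃ λ Δ′ → Rs ⊨ Δ′ × (∀ x a → ! Rs [ x ] ≡ just a → Δ′ x ≡ Δ x)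
  ⊨-complete {zero} [] typed = ∅ctx , emptyR , λ x a ()
  ⊨-complete {suc n} Rs {Δ} typed with initLast Rs
  ... | ys , nothing , refl
    with Δ′ , W , agree ← ⊨-complete ys (RegistersTyped-init nothing typed) =
    Δ′ , noneR W , agree′
    where
    agree′ : ∀ x a → ! (ys ∷ʳ nothing) [ x ] ≡ just a → Δ′ x ≡ Δ x
    agree′ x a Rx rewrite lookupD-∷ʳ nothing ys nothing x with x ≡ᵇ n
    ... | true with () ← Rx
    ... | false = agree x a Rx
  ... | ys , just b , refl
    with Δ′ , W , agree ← ⊨-complete ys (RegistersTyped-init (just b) typed)
       | τ , Δn , ⊢b ← content-∶ typed n b (lookupD-∷ʳ-last nothing ys (just b)) =
    Δ′ [ n ↦ τ ] , someR W ⊢b , agree′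
    where
    agree′ : ∀ x a → ! (ys ∷ʳ just b) [ x ] ≡ just a → (Δ′ [ n ↦ τ ]) x ≡ Δ x
    agree′ x a Rx rewrite lookupD-∷ʳ nothing ys (just b) x with x ≡ᵇ n in eq
    ... | true with refl ← ≡ᵇ-true⇒≡ x n eq = sym Δn
    ... | false = agree x a Rx

  ⊩-strengthen : ∀ (ini : Vec Bool n) {Δ Δ′ r P Tp α} → T (validP ini P) → Agree ini Δ Δ′ →
    Δ ⊩ r ⟨ P , Tp ⟩∶ α → Δ′ ⊩ r ⟨ P , Tp ⟩∶ α
  ⊩-strengthen ini v ag (loadE {i = i} {β = β} ⊢P) =
    loadE (⊩-strengthen (setD ini i true) v (Agree-[↦] ini ag i β) ⊢P)
  ⊩-strengthen ini v ag (loadT {i = i} {β = β} ⊢P ⊢a) =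
    loadT (⊩-strengthen (setD ini i true) v (Agree-[↦] ini ag i β) ⊢P) ⊢a
  ⊩-strengthen ini v ag (predT {i = i} {j} {P} Δi ⊢P) =
    let ti , vP = validB⇒ValidBody ini (pred i j P) v
    in predT (ag i int ti Δi) (⊩-strengthen (setD ini j true) vP (Agree-[↦] ini ag j int) ⊢P)
  ⊩-strengthen ini v ag (succT {i = i} {j} {P} Δi ⊢P) =
    let ti , vP = validB⇒ValidBody ini (succ i j P) v
    in succT (ag i int ti Δi) (⊩-strengthen (setD ini j true) vP (Agree-[↦] ini ag j int) ⊢P)
  ⊩-strengthen ini v ag (testT {i = i} {j} {k} {l} {P} {β = β} Δi Δj Δk ⊢P) =
    let ti , tj , tk , vP = validB⇒ValidBody ini (test i j k l P) v
    in testT (ag i int ti Δi) (ag j β tj Δj) (ag k β tk Δk)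
         (⊩-strengthen (setD ini l true) vP (Agree-[↦] ini ag l β) ⊢P)
  ⊩-strengthen ini v ag (appT {i = i} {j} {k} {P} {α = α} {β} Δi Δj ⊢P) =
    let ti , tj , vP = validB⇒ValidBody ini (app i j k P) v
    in appT (ag i (α ⇒ β) ti Δi) (ag j α tj Δj)
         (⊩-strengthen (setD ini k true) vP (Agree-[↦] ini ag k β) ⊢P)
  ⊩-strengthen ini v ag (callT {i = i} Ms αs ⊢Ms Δi) = callT Ms αs ⊢Ms (ag i _ v Δi)

  RegistersTyped⇒∶ : ∀ {r Rs P Tp Δ α} → RegistersTyped Rs Δ → Valid (mk r Rs P Tp) →
    Δ ⊩ r ⟨ P , Tp ⟩∶ α → mk r Rs P Tp ∶ α
  RegistersTyped⇒∶ {Rs = Rs} typed v ⊢P =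
    let Δ′ , W , agree = ⊨-complete Rs typed
    in machT W (⊩-strengthen (initOf Rs) v (λ x τ tx Δx →
         let a , Rx = initialised-register Rs x tx in trans (agree x a Rx) Δx) ⊢P)

  RegistersTyped-write : ∀ {Rs : Vec (Maybe (Addr X)) n} {Δ} k c β → RegistersTyped Rs Δ →
    ⌊ decode c ⌋ ∶ β → RegistersTyped (setD Rs k (just c)) (Δ [ k ↦ β ])
  RegistersTyped-write k c β typed ⊢c = RegistersTyped-[↦] k (just c) β typed λ { _ refl → ⊢c }

  RegistersTyped-overwrite : ∀ {Rs : Vec (Maybe (Addr X)) n} {Δ} i c β → RegistersTyped Rs Δ →
    Δ i ≡ just β → ⌊ decode c ⌋ ∶ β → RegistersTyped (setD Rs i (just c)) Δ
  RegistersTyped-overwrite {Δ = Δ} i c β typed Δi ⊢c =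
    RegistersTyped-≗ (RegistersTyped-write i c β typed ⊢c) ([↦]-redundant Δ i β Δi)

  Y-body-⊩ : ∀ α → (∅ctx [ 0 ↦ ((α ⇒ α) ⇒ α) ]) [ 1 ↦ (α ⇒ α) ]
    ⊩ 1 ⟨ body (app 0 1 0 (app 1 0 1 (cmd (call 1)))) , [] ⟩∶ α
  Y-body-⊩ α = appT refl refl (appT refl refl (callT [] [] [] refl))

  ⊩-append : ∀ {Δ r P Tp α β} (N : EAM X) → ⌊ N ⌋ ∶ β → Δ ⊩ r ⟨ P , Tp ⟩∶ (β ⇒ α) →
    Δ ⊩ r ⟨ P , Tp ++ encode N ∷ [] ⟩∶ α
  ⊩-append N ⊢N (loadE ⊢P)             = loadT ⊢P (decode-encode-∶ N ⊢N)
  ⊩-append N ⊢N (loadT ⊢P ⊢a)          = loadT (⊩-append N ⊢N ⊢P) ⊢a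
  ⊩-append N ⊢N (predT Δi ⊢P)          = predT Δi (⊩-append N ⊢N ⊢P)
  ⊩-append N ⊢N (succT Δi ⊢P)          = succT Δi (⊩-append N ⊢N ⊢P)
  ⊩-append N ⊢N (testT Δi Δj Δk ⊢P)    = testT Δi Δj Δk (⊩-append N ⊢N ⊢P)
  ⊩-append N ⊢N (appT Δi Δj ⊢P)        = appT Δi Δj (⊩-append N ⊢N ⊢P)
  ⊩-append {Δ} {r} {α = α} {β} N ⊢N (callT {i = i} Ms αs ⊢Ms Δi) =
    subst (λ Tp → Δ ⊩ r ⟨ body (cmd (call i)) , Tp ⟩∶ α) (map-++ encode Ms (N ∷ []))
      (callT (Ms ++ N ∷ []) (αs ++ β ∷ []) (++⁺ ⊢Ms (⊢N ∷ []))
        (trans Δi (cong just (sym (foldr-++ _⇒_ α αs (β ∷ []))))))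

  ∶-apply : ∀ {M α β} (N : EAM X) → M ∶ (β ⇒ α) → ⌊ N ⌋ ∶ β → M ⊕ʳ (encode N ∷ []) ∶ α
  ∶-apply N (YT α) ⊢N =
    machT (noneR (noneR emptyR)) (loadT (loadT (Y-body-⊩ α) (decode-encode-∶ N ⊢N)) (decode-Y-∶ α))
  ∶-apply N (machT W ⊢P) ⊢N = machT W (⊩-append N ⊢N ⊢P)

  ∶-applyAll : ∀ {M α} (Ms : List (EAM X)) αs → Pointwise (λ N β → ⌊ N ⌋ ∶ β) Ms αs →
    M ∶ (αs ⇛ α) → M ⊕ʳ map encode Ms ∶ α
  ∶-applyAll {mk r Rs P Tp} {α} [] [] [] ⊢M =
    subst (λ Tp′ → mk r Rs P Tp′ ∶ α) (sym (++-identityʳ Tp)) ⊢M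
  ∶-applyAll {mk r Rs P Tp} {α} (N ∷ Ms) (β ∷ αs) (⊢N ∷ ⊢Ms) ⊢M =
    subst (λ Tp′ → mk r Rs P Tp′ ∶ α) (++-assoc Tp (encode N ∷ []) (map encode Ms))
      (∶-applyAll Ms αs ⊢Ms (∶-apply N ⊢M ⊢N))

  ·-∶ : ∀ a b {α β} → ⌊ decode a ⌋ ∶ (α ⇒ β) → ⌊ decode b ⌋ ∶ α → ⌊ decode (a · b) ⌋ ∶ β
  ·-∶ a b {β = β} ⊢a ⊢b = ∶-subst (sym (decode-encode (decode a ⊕ (b ∷ []))))
    (subst (λ c → ⌊ decode a ⌋ ⊕ʳ (c ∷ []) ∶ β) (encode-decode b) (∶-apply (decode b) ⊢a ⊢b))

  subject-reduction : ∀ {M N α} → Valid N → M ∶ α → M ⟶ N → N ∶ α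
  ⊩-subject-reduction : ∀ {r Rs P Tp Δ α N} → Valid N → RegistersTyped Rs Δ →
    Δ ⊩ r ⟨ P , Tp ⟩∶ α → mk r Rs P Tp ⟶ N → N ∶ α
  RegistersTyped-reduced : ∀ {Rs : Vec (Maybe (Addr X)) n} {Δ i a β} (M′ : EAM X) →
    RegistersTyped Rs Δ → Δ i ≡ just β → ! Rs [ i ] ≡ just a → ⌊ decode a ⌋ ⟶ ⌊ M′ ⌋ →
    RegistersTyped (setD Rs i (just (encode M′))) Δ

  subject-reduction vN (YT α) loadS =
    machT (noneR (someR emptyR (decode-Y-∶ α))) (loadE (Y-body-⊩ α))
  subject-reduction vN (machT W ⊢P) step = ⊩-subject-reduction vN (⊨-sound W) ⊢P step

  ⊩-subject-reduction vN typed (callT {i = i} Ms αs ⊢Ms Δi) (callS Ri) =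
    ∶-applyAll Ms αs ⊢Ms (register-∶ typed i Δi _ Ri)
  ⊩-subject-reduction vN typed (loadT {i = i} {β = β} ⊢P ⊢a) (loadS {a = a}) =
    RegistersTyped⇒∶ (RegistersTyped-write i a β typed ⊢a) vN ⊢P
  ⊩-subject-reduction vN typed (appT {k = k} {β = β} Δi Δj ⊢P) (appS {i = i} {j} {a = a} {b} Ri Rj)
    =
    RegistersTyped⇒∶ (RegistersTyped-write k (a · b) β typed
      (·-∶ a b (register-∶ typed i Δi a Ri) (register-∶ typed j Δj b Rj))) vN ⊢P
  ⊩-subject-reduction vN typed (predT {j = j} _ ⊢P) (predS {n = n} _) =
    RegistersTyped⇒∶ (RegistersTyped-write j _ int typed (decode-numeral-∶ (n ∸ 1))) vN ⊢P
  ⊩-subject-reduction vN typed (succT {j = j} _ ⊢P) (succS {n = n} _) =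
    RegistersTyped⇒∶ (RegistersTyped-write j _ int typed (decode-numeral-∶ (suc n))) vN ⊢P
  ⊩-subject-reduction vN typed (testT {j = j} {l = l} {β = β} _ Δj _ ⊢P) (testZ _) =
    RegistersTyped⇒∶ (RegistersTyped-[↦] l _ β typed (register-∶ typed j Δj)) vN ⊢P
  ⊩-subject-reduction vN typed (testT {k = k} {l = l} {β = β} _ _ Δk ⊢P) (testS _) =
    RegistersTyped⇒∶ (RegistersTyped-[↦] l _ β typed (register-∶ typed k Δk)) vN ⊢P
  ⊩-subject-reduction vN typed ⊢P@(predT Δi _) (predE M′ Ri step) =
    RegistersTyped⇒∶ (RegistersTyped-reduced M′ typed Δi Ri step) vN ⊢P
  ⊩-subject-reduction vN typed ⊢P@(succT Δi _) (succE M′ Ri step) =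
    RegistersTyped⇒∶ (RegistersTyped-reduced M′ typed Δi Ri step) vN ⊢P
  ⊩-subject-reduction vN typed ⊢P@(testT Δi _ _ _) (testE M′ Ri step) =
    RegistersTyped⇒∶ (RegistersTyped-reduced M′ typed Δi Ri step) vN ⊢P

  RegistersTyped-reduced {i = i} M′ typed Δi Ri step =
    RegistersTyped-overwrite i _ _ typed Δi
      (decode-encode-∶ M′ (subject-reduction (proj₂ M′) (register-∶ typed i Δi _ Ri) step))

  IsNumeral : Raw X → Set
  IsNumeral M = ∃ λ n → M ≡ numeralʳ n

  Reducible : Raw X → Set
  Reducible M = ∃ λ (N : EAM X) → M ⟶ ⌊ N ⌋

  Progress : Raw X → Set
  Progress M = IsNumeral M ⊎ Reducible M

  IntRegistersProgress : Vec (Maybe (Addr X)) n → Ctx → Set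
  IntRegistersProgress Rs Δ = ∀ x a → ! Rs [ x ] ≡ just a → Δ x ≡ just int → Progress ⌊ decode a ⌋

  reducible : ∀ {M N} → Valid M → M ⟶ N → Reducible M
  reducible v step = (_ , ⟶-Valid v step) , step

  int-register : ∀ (Rs : Vec (Maybe (Addr X)) n) {Δ i} → IntRegistersProgress Rs Δ →
    Initialised (initOf Rs) i → Δ i ≡ just int →
    (∃ λ m → ! Rs [ i ] ≡ just (inj₁ m)) ⊎ (∃ λ a → ! Rs [ i ] ≡ just a × Reducible ⌊ decode a ⌋)
  int-register Rs {i = i} ok ti Δi with a , Ri ← initialised-register Rs i ti with ok i a Ri Δi
  ... | inj₁ (m , decode-a) = inj₁ (m , trans Ri (cong just (decode≡numeral a decode-a)))
  ... | inj₂ reducible-a    = inj₂ (a , Ri , reducible-a)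

  -- No typing rule covers the empty program ε, so only numerals can be final.
  progress : ∀ {M} → M ∶ int → Valid M → Progress M
  ⊨-progress : ∀ {Rs : Vec (Maybe (Addr X)) n} {Δ} → Rs ⊨ Δ → IntRegistersProgress Rs Δ
  ⊩-progress : ∀ {r Rs P Tp Δ} → IntRegistersProgress Rs Δ → Valid (mk r Rs P Tp) →
    Δ ⊩ r ⟨ P , Tp ⟩∶ int → Reducible (mk r Rs P Tp)

  progress (numT n)     v = inj₁ (n , refl)
  progress (machT W ⊢P) v = inj₂ (⊩-progress (⊨-progress W) v ⊢P)

  ⊨-progress emptyR x a ()
  ⊨-progress (noneR {n = m} {Rs = Rs} W) x a Rx Δx
    rewrite lookupD-∷ʳ nothing Rs nothing x with x ≡ᵇ m
  ... | true with () ← Rx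
  ... | false = ⊨-progress W x a Rx Δx
  ⊨-progress (someR {n = m} {Rs = Rs} {a = b} W ⊢b) x a Rx Δx
    rewrite lookupD-∷ʳ nothing Rs (just b) x with x ≡ᵇ m
  ... | true with refl ← Rx | refl ← Δx = progress ⊢b (proj₂ (decode b))
  ... | false = ⊨-progress W x a Rx Δx

  ⊩-progress ok v (loadT ⊢P ⊢a) = reducible v loadS
  ⊩-progress {Rs = Rs} {body B} ok v (appT {i = i} {j} _ _ _)
    with ti , tj , _ ← validB⇒ValidBody (initOf Rs) B v
    with _ , Ri ← initialised-register Rs i ti | _ , Rj ← initialised-register Rs j tj =
    reducible v (appS Ri Rj)
  ⊩-progress {Rs = Rs} ok v (callT {i = i} _ _ _ _) with _ , Ri ← initialised-register Rs i v =
    reducible v (callS Ri)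
  ⊩-progress {Rs = Rs} {body B} ok v (predT Δi _)
    with int-register Rs ok (proj₁ (validB⇒ValidBody (initOf Rs) B v)) Δi
  ... | inj₁ (_ , Ri)               = reducible v (predS Ri)
  ... | inj₂ (_ , Ri , N , step)    = reducible v (predE N Ri step)
  ⊩-progress {Rs = Rs} {body B} ok v (succT Δi _)
    with int-register Rs ok (proj₁ (validB⇒ValidBody (initOf Rs) B v)) Δi
  ... | inj₁ (_ , Ri)               = reducible v (succS Ri)
  ... | inj₂ (_ , Ri , N , step)    = reducible v (succE N Ri step)
  ⊩-progress {Rs = Rs} {body B} ok v (testT Δi _ _ _)
    with int-register Rs ok (proj₁ (validB⇒ValidBody (initOf Rs) B v)) Δi
  ... | inj₁ (zero , Ri)            = reducible v (testZ Ri)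
  ... | inj₁ (suc _ , Ri)           = reducible v (testS Ri)
  ... | inj₂ (_ , Ri , N , step)    = reducible v (testE N Ri step)

  progress-not-stuck : ∀ {a} → Progress ⌊ decode a ⌋ → NotNat a → ¬ CannotReduce ⌊ decode a ⌋
  progress-not-stuck {a} (inj₁ (n , decode-a)) notNat _ = notNat n (decode≡numeral a decode-a)
  progress-not-stuck (inj₂ (_ , step)) _ stuck = stuck _ step

  ⊩-not-error : ∀ {r Rs P Tp Δ α} → IntRegistersProgress Rs Δ → Δ ⊩ r ⟨ P , Tp ⟩∶ α →
    ¬ ErrorState (mk r Rs P Tp)
  ⊩-not-error ok (predT Δi _)     (predErr Ri notNat stuck) =
    progress-not-stuck (ok _ _ Ri Δi) notNat stuck
  ⊩-not-error ok (succT Δi _)     (succErr Ri notNat stuck) =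
    progress-not-stuck (ok _ _ Ri Δi) notNat stuck
  ⊩-not-error ok (testT Δi _ _ _) (testErr Ri notNat stuck) =
    progress-not-stuck (ok _ _ Ri Δi) notNat stuck

  ∶-not-error : ∀ {M α} → M ∶ α → ¬ ErrorState M
  ∶-not-error (machT W ⊢P) = ⊩-not-error (⊨-progress W) ⊢P

  subject-reduction* : ∀ {M N α} → Valid M → M ∶ α → M ⟶* N → Valid N × N ∶ α
  subject-reduction* v ⊢M ◅ε = v , ⊢M
  subject-reduction* v ⊢M (step ◅ steps) =
    let v′ = ⟶-Valid v step in subject-reduction* v′ (subject-reduction v′ ⊢M step) steps

  never-raises-error : ∀ (M : EAM X) α → ⌊ M ⌋ ∶ α → ¬ RaisesError ⌊ M ⌋
  never-raises-error (M , v) α ⊢M (_ , steps , error) =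
    ∶-not-error (proj₂ (subject-reduction* v ⊢M steps)) error

  int-terminates-at-numeral : ∀ (M : EAM X) → ⌊ M ⌋ ∶ int → Terminates ⌊ M ⌋ →
    ∃ λ n → ⌊ M ⌋ ⟶* numeralʳ n
  int-terminates-at-numeral M ⊢M (inj₁ raises) = ⊥-elim (never-raises-error M int ⊢M raises)
  int-terminates-at-numeral (M , v) ⊢M (inj₂ (_ , steps , _ , final))
    with v′ , ⊢M′ ← subject-reduction* v ⊢M steps with progress ⊢M′ v′
  ... | inj₁ (n , refl)  = n , steps
  ... | inj₂ (_ , step)  = ⊥-elim (final _ step)

proposition3p18 : ∀ {X : Set} (S : Setting X) → let open Semantics S in
    (∀ (M N : EAM X) (α β : Ty) → ⌊ M ⌋ ∶ (β ⇒ α) → ⌊ N ⌋ ∶ β → ⌊ M ⊕ (encode N ∷ []) ⌋ ∶ α)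
    × (∀ (M N : EAM X) (α : Ty) → ⌊ M ⌋ ∶ α → ⌊ M ⌋ ⟶ ⌊ N ⌋ → ⌊ N ⌋ ∶ α)
    × (∀ (M : EAM X) → ⌊ M ⌋ ∶ int → Terminates ⌊ M ⌋ → ∃ λ (n : ℕ) → ⌊ M ⌋ ⟶* numeralʳ n)
    × (∀ (M : EAM X) (α : Ty) → ⌊ M ⌋ ∶ α → ¬ RaisesError ⌊ M ⌋)
proposition3p18 S =
    (λ M N α β ⊢M ⊢N → ∶-apply N ⊢M ⊢N)
  , (λ M N α ⊢M step → subject-reduction (proj₂ N) ⊢M step)
  , int-terminates-at-numeral
  , never-raises-error
  where open Properties S
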